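{- Let $n\ge 1$ and $\sigma\in\mathfrak{S}_n$. Then $\phi^{ -1}(\sigma)=f=f_1f_2\cdots f_n$, where for every $i\in[n]$, $f_i=\sigma^{t}(i)$ and $t$ is the smallest positive integer such that $\sigma^{t}(i)\le i$.
   Context: $[n]=\{1,\dots,n\}$ and $\mathfrak{S}_n$ is the symmetric group on $[n]$. Products of permutations are composed with the leftmost factor acting first: $(\alpha\beta)(x)=\beta(\alpha(x))$. A function $f:[n]\to[n]$ is subexceedant if $1\le f(i)\le i$ for all $i$; it is written as the word $f_1f_2\cdots f_n$ with $f_i=f(i)$, and $F_n$ denotes the set of subexceedant functions on $[n]$. The map $\phi:F_n\to\mathfrak{S}_n$ is defined by $\phi(f)=(1,f_1)(2,f_2)\cdots(n,f_n)$, a product of transpositions, where $(i,i)$ denotes the identity; $\phi$ is a bijection. -}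

module Defs where

open import Data.Nat using (ℕ; zero; suc; _≤_; _<_)
open import Data.Fin using (Fin; toℕ)
open import Data.Fin.Permutation using (Permutation′; _⟨$⟩ʳ_; _∘ₚ_; transpose; id)
open import Data.List using (foldl; allFin)
open import Data.Product using (Σ; _×_; _,_)
open import Relation.Binary.PropositionalEquality using (_≡_)

-- Convention: [n] = {1,…,n} is represented by Fin n (element k ↦ k+1);
-- this shift preserves the order, so ≤ on [n] is ≤ on toℕ.

-- f is subexceedant: f(i) ≤ i for all i (1 ≤ f(i) is automatic).
Subexceedant : {n : ℕ} → (Fin n → Fin n) → Set
Subexceedant f = ∀ i → toℕ (f i) ≤ toℕ i

F : ℕ → Set
F n = Σ (Fin n → Fin n) Subexceedant

-- φ(f) = (1,f₁)(2,f₂)⋯(n,fₙ), leftmost factor acting first.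
-- In the stdlib, (π₁ ∘ₚ π₂) applies π₁ first, matching the paper.
-- transpose i i is the identity.
φ : {n : ℕ} → F n → Permutation′ n
φ {n} (f , _) = foldl (λ acc i → acc ∘ₚ transpose i (f i)) id (allFin n)

_^_⟨$⟩_ : {n : ℕ} → Permutation′ n → ℕ → Fin n → Fin n
σ ^ zero ⟨$⟩ x = x
σ ^ suc t ⟨$⟩ x = σ ⟨$⟩ʳ (σ ^ t ⟨$⟩ x)

IsLeastReturn : {n : ℕ} → Permutation′ n → Fin n → ℕ → Set
IsLeastReturn σ i t =
  1 ≤ t × toℕ (σ ^ t ⟨$⟩ i) ≤ toℕ i ×
  (∀ s → 1 ≤ s → s < t → toℕ i < toℕ (σ ^ s ⟨$⟩ i))

module Submission where

-- Write πₖ = (1,f₁)(2,f₂)⋯(k,fₖ). By induction on k, πₖ is the permutation induced by σ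
-- on [k]: it sends x ∈ [k] to the first point of its forward σ-orbit lying in [k] (such a
-- point exists because orbits are periodic) and fixes every x > k. Passing from [k] to
-- [k+1] only reroutes through k+1: an orbit from x ∈ [k] that passed through k+1 now stops
-- there, while k+1 goes on to its own first return f_{k+1}, and orbits that avoid k+1 keep
-- their endpoint, which by injectivity of first returns is not f_{k+1}. That is exactly
-- composition with the transposition (k+1, f_{k+1}). For k = n the induced map is σ.

open import Defs
open import Data.Nat using (ℕ; zero; suc; s≤s⁻¹; _+_; _≤_; _<_; _≤?_; _<?_; z≤n; s≤s)
open import Data.Nat.Properties hiding (_≟_)
import Data.Fin as Fin
open import Data.Fin using (Fin; toℕ)
open import Data.Fin.Properties using (toℕ-injective; toℕ<n; pigeonhole; _≟_)
open import Data.Fin.Permutation using (Permutation′; _≈_; _⟨$⟩ʳ_; _∘ₚ_; transpose; id)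
import Data.Fin.Permutation.Components as PC
open import Data.List using (foldl; tabulate; allFin)
open import Data.Product using (Σ; ∃; _×_; _,_; proj₁; proj₂)
open import Data.Sum using (_⊎_; inj₁; inj₂; [_,_])
open import Function using (_∘_)
open import Function.Bundles using (Injection)
open import Function.Properties.Inverse using (↔⇒↣)
open import Relation.Binary.Definitions using (tri<; tri≈; tri>)
open import Relation.Nullary using (¬_; Dec; yes; no; contradiction)
open import Relation.Nullary.Decidable using (dec-true; _×-dec_)
open import Relation.Binary.PropositionalEquality
  using (_≡_; _≢_; refl; sym; trans; cong; subst; module ≡-Reasoning)

transpose-matchˡ : ∀ {n} (i j : Fin n) → PC.transpose i j i ≡ j
transpose-matchˡ i j rewrite dec-true (i ≟ i) refl = refl

transpose-matchʳ : ∀ {n} (i j : Fin n) → PC.transpose i j j ≡ i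
transpose-matchʳ i j with j ≟ i
... | yes j≡i = j≡i
... | no _ rewrite dec-true (j ≟ j) refl = refl

transpose-mismatch : ∀ {n} {i j k : Fin n} → k ≢ i → k ≢ j → PC.transpose i j k ≡ k
transpose-mismatch {i = i} {j} {k} k≢i k≢j with k ≟ i
... | yes k≡i = contradiction k≡i k≢i
... | no _ with k ≟ j
...   | yes k≡j = contradiction k≡j k≢j
...   | no _ = refl

module _ {P : ℕ → Set} (P? : ∀ m → Dec (P m)) where

  Least : ℕ → Set
  Least m = P m × (∀ k → k < m → ¬ P k)

  least-below : ∀ b → (∀ k → k < b → ¬ P k) ⊎ ∃ Least
  least-below zero = inj₁ λ _ ()
  least-below (suc b) with least-below b
  ... | inj₂ found = inj₂ found
  ... | inj₁ none with P? b
  ...   | yes p = inj₂ (b , p , none)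
  ...   | no ¬p = inj₁ λ k k<1+b → [ none k , (λ { refl → ¬p }) ] (m<1+n⇒m<n∨m≡n k<1+b)

  least : ∀ {m} → P m → ∃ Least
  least {m} p with least-below (suc m)
  ... | inj₁ none = contradiction p (none m ≤-refl)
  ... | inj₂ found = found

<⇒≡+suc : ∀ {m n} → m < n → ∃ λ d → n ≡ m + suc d
<⇒≡+suc {m} m<n with m≤n⇒∃[o]m+o≡n m<n
... | d , 1+m+d≡n = d , trans (sym 1+m+d≡n) (sym (+-suc m d))

module _ {n : ℕ} (σ : Permutation′ n) where

  ^-+ˡ : ∀ a b x → σ ^ (a + b) ⟨$⟩ x ≡ σ ^ a ⟨$⟩ (σ ^ b ⟨$⟩ x)
  ^-+ˡ zero    b x = refl
  ^-+ˡ (suc a) b x = cong (σ ⟨$⟩ʳ_) (^-+ˡ a b x)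

  ^-+ʳ : ∀ a b x → σ ^ (a + b) ⟨$⟩ x ≡ σ ^ b ⟨$⟩ (σ ^ a ⟨$⟩ x)
  ^-+ʳ a b x = trans (cong (σ ^_⟨$⟩ x) (+-comm a b)) (^-+ˡ b a x)

  ^-injective : ∀ t {x y} → σ ^ t ⟨$⟩ x ≡ σ ^ t ⟨$⟩ y → x ≡ y
  ^-injective zero    eq = eq
  ^-injective (suc t) eq = ^-injective t (Injection.injective (↔⇒↣ σ) eq)

  ^-periodic : ∀ x → ∃ λ p → 1 ≤ p × σ ^ p ⟨$⟩ x ≡ x
  ^-periodic x with pigeonhole (n<1+n n) (λ j → σ ^ toℕ j ⟨$⟩ x)
  ... | i , j , i<j , eq with <⇒≡+suc i<j
  ...   | d , j≡i+1+d = suc d , s≤s z≤n , sym (^-injective (toℕ i) (begin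
    σ ^ toℕ i ⟨$⟩ x                       ≡⟨ eq ⟩
    σ ^ toℕ j ⟨$⟩ x                       ≡⟨ cong (σ ^_⟨$⟩ x) j≡i+1+d ⟩
    σ ^ (toℕ i + suc d) ⟨$⟩ x             ≡⟨ ^-+ˡ (toℕ i) (suc d) x ⟩
    σ ^ toℕ i ⟨$⟩ (σ ^ suc d ⟨$⟩ x)       ∎))
    where open ≡-Reasoning

  ReturnsAt : ℕ → Fin n → ℕ → Set
  ReturnsAt k x t =
    1 ≤ t × toℕ (σ ^ t ⟨$⟩ x) < k × (∀ s → 1 ≤ s → s < t → k ≤ toℕ (σ ^ s ⟨$⟩ x))

  FirstReturn : ℕ → Fin n → Fin n → Set
  FirstReturn k x y = Σ ℕ λ t → ReturnsAt k x t × σ ^ t ⟨$⟩ x ≡ y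

  firstReturn-< : ∀ {k x y} → FirstReturn k x y → toℕ y < k
  firstReturn-< (_ , (_ , below , _) , refl) = below

  returnsAt-unique : ∀ {k x t t′} → ReturnsAt k x t → ReturnsAt k x t′ → t ≡ t′
  returnsAt-unique {t = t} {t′} (1≤t , below , before) (1≤t′ , below′ , before′) with <-cmp t t′
  ... | tri< t<t′ _ _ = contradiction (before′ t 1≤t t<t′) (<⇒≱ below)
  ... | tri≈ _ t≡t′ _ = t≡t′
  ... | tri> _ _ t′<t = contradiction (before t′ 1≤t′ t′<t) (<⇒≱ below′)

  firstReturn-unique : ∀ {k x y y′} → FirstReturn k x y → FirstReturn k x y′ → y ≡ y′
  firstReturn-unique {x = x} (t , r , refl) (t′ , r′ , refl) = cong (σ ^_⟨$⟩ x) (returnsAt-unique r r′)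

  returnsAt-disjoint : ∀ {k x x′ t t′} → toℕ x < k → ReturnsAt k x t → ReturnsAt k x′ t′ → t < t′ →
                       σ ^ t ⟨$⟩ x ≢ σ ^ t′ ⟨$⟩ x′
  returnsAt-disjoint {x = x} {x′} {t} x<k (1≤t , _) (_ , _ , before′) t<t′ eq with <⇒≡+suc t<t′
  ... | d , refl = <⇒≱ x<k (subst (λ w → _ ≤ toℕ w) (sym x≡σᵈx′)
                              (before′ (suc d) (s≤s z≤n) (m<n+m (suc d) 1≤t)))
    where
    x≡σᵈx′ : x ≡ σ ^ suc d ⟨$⟩ x′
    x≡σᵈx′ = ^-injective t (trans eq (^-+ˡ t (suc d) x′))

  firstReturn-injective : ∀ {k x x′ y} → toℕ x < k → toℕ x′ < k →
                          FirstReturn k x y → FirstReturn k x′ y → x ≡ x′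
  firstReturn-injective x<k x′<k (t , r , eq) (t′ , r′ , eq′) with <-cmp t t′
  ... | tri< t<t′ _ _ = contradiction (trans eq (sym eq′)) (returnsAt-disjoint x<k r r′ t<t′)
  ... | tri≈ _ refl _ = ^-injective t (trans eq (sym eq′))
  ... | tri> _ _ t′<t = contradiction (trans eq′ (sym eq)) (returnsAt-disjoint x′<k r′ r t′<t)

  firstReturn-exists : ∀ {k x} → toℕ x < k → ∃ (FirstReturn k x)
  firstReturn-exists {k} {x} x<k with ^-periodic x
  ... | p , 1≤p , σᵖx≡x with least (λ s → 1 ≤? s ×-dec toℕ (σ ^ s ⟨$⟩ x) <? k)
                                   (1≤p , subst (λ y → toℕ y < k) (sym σᵖx≡x) x<k)
  ...   | t , (1≤t , below) , earlier =
    σ ^ t ⟨$⟩ x , t , (1≤t , below , λ s 1≤s s<t → ≮⇒≥ λ s-below → earlier s s<t (1≤s , s-below)) , refl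

  firstReturn-mono : ∀ {k k′ x y} → k′ ≤ k → toℕ y < k′ → FirstReturn k x y → FirstReturn k′ x y
  firstReturn-mono k′≤k y<k′ (t , (1≤t , _ , before) , refl) =
    t , (1≤t , y<k′ , λ s 1≤s s<t → ≤-trans k′≤k (before s 1≤s s<t)) , refl

  firstReturn-trans : ∀ {k k′ x y z} → k′ ≤ k → k′ ≤ toℕ z → toℕ y < k′ →
                      FirstReturn k x z → FirstReturn k z y → FirstReturn k′ x y
  firstReturn-trans {k} {k′} {x} k′≤k k′≤z y<k′ (s , (1≤s , _ , before) , refl) (u , (_ , _ , before′) , refl) =
    s + u , (≤-trans 1≤s (m≤m+n s u) , subst (λ w → toℕ w < k′) (sym (^-+ʳ s u x)) y<k′ , between) , ^-+ʳ s u x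
    where
    between : ∀ r → 1 ≤ r → r < s + u → k′ ≤ toℕ (σ ^ r ⟨$⟩ x)
    between r 1≤r r<s+u with <-cmp r s
    ... | tri< r<s _ _ = ≤-trans k′≤k (before r 1≤r r<s)
    ... | tri≈ _ refl _ = k′≤z
    ... | tri> _ _ s<r with <⇒≡+suc s<r
    ...   | d , refl = subst (λ w → k′ ≤ toℕ w) (sym (^-+ʳ s (suc d) x))
                         (≤-trans k′≤k (before′ (suc d) (s≤s z≤n) (+-cancelˡ-< s (suc d) u r<s+u)))

  firstReturn-suc : ∀ {k x y z a} → toℕ z ≡ k → FirstReturn (suc k) z a →
                    toℕ x < k → FirstReturn k x y → FirstReturn (suc k) x (PC.transpose z a y)
  firstReturn-suc {k} {x} {y} {z} {a} z≡k z↦a x<k x↦y = landing (firstReturn-exists x<1+k)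
    where
    x<1+k : toℕ x < suc k
    x<1+k = m<n⇒m<1+n x<k

    x≢z : x ≢ z
    x≢z x≡z = <⇒≢ x<k (trans (cong toℕ x≡z) z≡k)

    x↦v⇒v≢a : ∀ {v} → FirstReturn (suc k) x v → v ≢ a
    x↦v⇒v≢a x↦v refl = x≢z (firstReturn-injective x<1+k (≤-reflexive (cong suc z≡k)) x↦v z↦a)

    avoiding-z : ∀ {w} → toℕ w < k → FirstReturn (suc k) x w → FirstReturn (suc k) x (PC.transpose z a y)
    avoiding-z {w} w<k x↦w = subst (FirstReturn (suc k) x) (sym τy≡w) x↦w
      where
      y≡w : y ≡ w
      y≡w = firstReturn-unique x↦y (firstReturn-mono (n≤1+n k) w<k x↦w)
      τy≡w : PC.transpose z a y ≡ w
      τy≡w = trans (cong (PC.transpose z a) y≡w)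
                   (transpose-mismatch (λ w≡z → <⇒≢ w<k (trans (cong toℕ w≡z) z≡k)) (x↦v⇒v≢a x↦w))

    through-z : FirstReturn (suc k) x z → FirstReturn (suc k) x (PC.transpose z a y)
    through-z x↦z = subst (FirstReturn (suc k) x) (sym τy≡z) x↦z
      where
      a<k : toℕ a < k
      a<k = ≤∧≢⇒< (s≤s⁻¹ (firstReturn-< z↦a))
                  (λ a≡k → x↦v⇒v≢a x↦z (toℕ-injective (trans z≡k (sym a≡k))))
      y≡a : y ≡ a
      y≡a = firstReturn-unique x↦y (firstReturn-trans (n≤1+n k) (≤-reflexive (sym z≡k)) a<k x↦z z↦a)
      τy≡z : PC.transpose z a y ≡ z
      τy≡z = trans (cong (PC.transpose z a) y≡a) (transpose-matchʳ z a)

    landing : ∃ (FirstReturn (suc k) x) → FirstReturn (suc k) x (PC.transpose z a y)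
    landing (w , x↦w) with m<1+n⇒m<n∨m≡n (firstReturn-< x↦w)
    ... | inj₁ w<k = avoiding-z w<k x↦w
    ... | inj₂ w≡k = through-z (subst (FirstReturn (suc k) x) (toℕ-injective (trans w≡k (sym z≡k))) x↦w)

  isLeastReturn⇒returnsAt : ∀ {i t} → IsLeastReturn σ i t → ReturnsAt (suc (toℕ i)) i t
  isLeastReturn⇒returnsAt (1≤t , returned , before) = 1≤t , s≤s returned , before

  returnsAt⇒isLeastReturn : ∀ {i t} → ReturnsAt (suc (toℕ i)) i t → IsLeastReturn σ i t
  returnsAt⇒isLeastReturn (1≤t , returned , before) = 1≤t , s≤s⁻¹ returned , before

  Induced : ℕ → Permutation′ n → Set
  Induced k π = ∀ x → (toℕ x < k → FirstReturn k x (π ⟨$⟩ʳ x)) × (k ≤ toℕ x → π ⟨$⟩ʳ x ≡ x)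

  induced-zero : Induced 0 id
  induced-zero x = (λ ()) , λ _ → refl

  induced-suc : ∀ {k z a} π → toℕ z ≡ k → FirstReturn (suc k) z a →
                Induced k π → Induced (suc k) (π ∘ₚ transpose z a)
  induced-suc {k} {z} {a} π z≡k z↦a induced x = returns , fixed
    where
    returns : toℕ x < suc k → FirstReturn (suc k) x (PC.transpose z a (π ⟨$⟩ʳ x))
    returns x<1+k with m<1+n⇒m<n∨m≡n x<1+k
    ... | inj₁ x<k = firstReturn-suc z≡k z↦a x<k (proj₁ (induced x) x<k)
    ... | inj₂ x≡k with toℕ-injective (trans x≡k (sym z≡k))
    ...   | refl rewrite proj₂ (induced x) (≤-reflexive (sym x≡k)) | transpose-matchˡ x a = z↦a

    fixed : suc k ≤ toℕ x → PC.transpose z a (π ⟨$⟩ʳ x) ≡ x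
    fixed k<x rewrite proj₂ (induced x) (<⇒≤ k<x) =
      transpose-mismatch (λ x≡z → <⇒≢ k<x (sym (trans (cong toℕ x≡z) z≡k)))
                         (λ x≡a → <⇒≱ (firstReturn-< z↦a) (subst (λ v → suc k ≤ toℕ v) x≡a k<x))

  induced-all : ∀ π → Induced n π → π ≈ σ
  induced-all π induced x with proj₁ (induced x) (toℕ<n x)
  ... | suc zero , _ , π⟨x⟩≡σ⟨x⟩ = sym π⟨x⟩≡σ⟨x⟩
  ... | suc (suc t) , (_ , _ , before) , _ =
    contradiction (before 1 ≤-refl (s≤s (s≤s z≤n))) (<⇒≱ (toℕ<n (σ ⟨$⟩ʳ x)))

foldl-tabulate-invariant : ∀ {a} {A : Set a} {n} (P : ℕ → A → Set) (g : A → Fin n → A) →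
                           (∀ {k} acc x → toℕ x ≡ k → P k acc → P (suc k) (g acc x)) →
                           ∀ {m k l} (h : Fin m → Fin n) → (∀ j → toℕ (h j) ≡ k + toℕ j) → k + m ≡ l →
                           ∀ {acc} → P k acc → P l (foldl g acc (tabulate h))
foldl-tabulate-invariant P g step {zero} {k} h h≡k+j k+0≡l {acc} p =
  subst (λ i → P i acc) (trans (sym (+-identityʳ k)) k+0≡l) p
foldl-tabulate-invariant P g step {suc m} {k} h h≡k+j k+1+m≡l p =
  foldl-tabulate-invariant P g step (h ∘ Fin.suc)
    (λ j → trans (h≡k+j (Fin.suc j)) (+-suc k (toℕ j))) (trans (sym (+-suc k m)) k+1+m≡l)
    (step _ (h Fin.zero) (trans (h≡k+j Fin.zero) (+-identityʳ k)) p)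

foldl-allFin-invariant : ∀ {a} {A : Set a} {n} (P : ℕ → A → Set) (g : A → Fin n → A) →
                         (∀ {k} acc x → toℕ x ≡ k → P k acc → P (suc k) (g acc x)) →
                         ∀ {acc} → P 0 acc → P n (foldl g acc (allFin n))
foldl-allFin-invariant {n = n} P g step = foldl-tabulate-invariant P g step (λ j → j) (λ _ → refl) refl

theorem3p1 : (n : ℕ) → 1 ≤ n → (σ : Permutation′ n) →
    (∀ i → Σ ℕ (λ t → IsLeastReturn σ i t)) ×
    ((f : Fin n → Fin n) →
      (∀ i → Σ ℕ (λ t → IsLeastReturn σ i t × f i ≡ σ ^ t ⟨$⟩ i)) →
      Σ (Subexceedant f) (λ sub → φ (f , sub) ≈ σ))
theorem3p1 n _ σ = leastReturn , φ-inverse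
  where
  leastReturn : ∀ i → Σ ℕ (λ t → IsLeastReturn σ i t)
  leastReturn i with firstReturn-exists σ {suc (toℕ i)} ≤-refl
  ... | _ , t , returns , _ = t , returnsAt⇒isLeastReturn σ returns

  φ-inverse : (f : Fin n → Fin n) → (∀ i → Σ ℕ (λ t → IsLeastReturn σ i t × f i ≡ σ ^ t ⟨$⟩ i)) →
              Σ (Subexceedant f) (λ sub → φ (f , sub) ≈ σ)
  φ-inverse f f-returns =
    subexceedant ,
    induced-all σ (φ (f , subexceedant))
      (foldl-allFin-invariant (Induced σ) (λ π i → π ∘ₚ transpose i (f i)) step (induced-zero σ))
    where
    i↦fi : ∀ i → FirstReturn σ (suc (toℕ i)) i (f i)
    i↦fi i with f-returns i
    ... | t , returns , fi≡σᵗi = t , isLeastReturn⇒returnsAt σ returns , sym fi≡σᵗi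

    subexceedant : Subexceedant f
    subexceedant i = s≤s⁻¹ (firstReturn-< σ (i↦fi i))

    step : ∀ {k} π i → toℕ i ≡ k → Induced σ k π → Induced σ (suc k) (π ∘ₚ transpose i (f i))
    step π i refl = induced-suc σ π refl (i↦fi i)
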